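{- For all $M,N\in\mathcal{M}$: (i) if $M\to_c N$ then $M\equiv_{\mathbb{A}}N$; (ii) if $M\twoheadrightarrow_c N$ then $M\equiv_{\mathbb{A}}N$.
   Context: Addressing machines. Fix a countable set $\mathbb{A}$ of addresses and a symbol $\varnothing\notin\mathbb{A}$; $\mathbb{A}_\varnothing=\mathbb{A}\cup\{\varnothing\}$. A tape is a finite list of elements of $\mathbb{A}$; $a::T$ has head $a$ and tail $T$, $T@T'$ is concatenation. A program is a finite list of instructions generated by $P::=\mathtt{Load}\ i;P\mid A$, $A::=\mathtt{App}(i,j,k);A\mid C$, $C::=\mathtt{Call}\ i\mid\varepsilon$ ($i,j,k\in\mathbb{N}$). For $r\in\mathbb{N}$, $I\subseteq\{0,\dots,r-1\}$, $I\models^r P$ is the least relation such that: $I\models^r\varepsilon$; $I\models^r\mathtt{Call}\ i$ if $i\in I$; $I\models^r\mathtt{App}(i,j,k);A$ if $i,j\in I$ and either ($k<r$ and $I\cup\{k\}\models^r A$) or ($k\ge r$ and $I\models^r A$); $I\models^r\mathtt{Load}\ i;P$ if either ($i<r$ and $I\cup\{i\}\models^r P$) or ($i\ge r$ and $I\models^r P$). An addressing machine is $M=\langle R_0,\dots,R_{r-1},P,T\rangle$ with registers in $\mathbb{A}_\varnothing$, $P$ valid w.r.t. the registers ($\{i<r\mid R_i\ne\varnothing\}\models^r P$), and a tape $T$; $\mathcal{M}$ is the set of all of them. $\vec R[R_i:=a]$ replaces $R_i$ by $a$ if $i<r$, is $\vec R$ if $i\ge r$. Fix a bijection $\#:\mathcal{M}\to\mathbb{A}$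 with inverse $\#^{ -1}$; $M@T'=\langle M.\vec R,M.P,M.T@T'\rangle$; $a\cdot b=\#(\#^{ -1}(a)@[b])$. Head reduction: $\langle\vec R,\mathtt{Load}\ i;P,a::T\rangle\to_h\langle\vec R[R_i:=a],P,T\rangle$, $\langle\vec R,\mathtt{App}(i,j,k);P,T\rangle\to_h\langle\vec R[R_k:=R_i\cdot R_j],P,T\rangle$, $\langle\vec R,\mathtt{Call}\ i,T\rangle\to_h\#^{ -1}(R_i)@T$; $\twoheadrightarrow_h$ reflexive-transitive closure. Induced relations: for a relation $\equiv_R$ on $\mathcal{M}$, $a\simeq_R b$ iff $\#^{ -1}(a)\equiv_R\#^{ -1}(b)$; on $\mathbb{A}_\varnothing$, both $\varnothing$ or both addresses related; componentwise on tuples/tapes of equal length; $M=_R N$ iff $M.\vec R\simeq_R N.\vec R$, $M.P=N.P$, $M.T\simeq_R N.T$. $\equiv_{\mathbb{A}}$ is the least equivalence relation on $\mathcal{M}$ such that $M\twoheadrightarrow_h Z$ and $Z=_{\mathbb{A}}N$ imply $M\equiv_{\mathbb{A}}N$ ($=_{\mathbb{A}}$ induced by $\equiv_{\mathbb{A}}$). The reduction $\to_c$ is the least relation on $\mathcal{M}$ containing $\to_h$ and closed under: if $0\le i<r$, $R_i=a\in\mathbb{A}$ and $\#^{ -1}(a)\to_c M'$, then $\langle\vec R,P,T\rangle\to_c\langle\vec R[R_i:=\#M'],P,T\rangle$; if $T=[a_0,\dots,a_n]$, $0\le i\le n$ and $\#^{ -1}(a_i)\to_c M'$, then $\langle\vec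 R,P,T\rangle\to_c\langle\vec R,P,[a_0,\dots,a_{i-1},\#M',a_{i+1},\dots,a_n]\rangle$. $\twoheadrightarrow_c$ is its reflexive-transitive closure. -}

module Defs where

open import Data.Nat using (ℕ; zero; suc; _<_; _≥_; _<ᵇ_; _≡ᵇ_)
open import Data.Bool using (Bool; true; false; _∧_; _∨_; T)
open import Data.Maybe using (Maybe; just; nothing; is-just)
open import Data.List using (List; []; _∷_; _++_)
open import Data.Vec using (Vec; []; _∷_)
open import Data.Product using (_×_; _,_)
open import Function.Bundles using (_↔_; Inverse)
open import Relation.Binary.PropositionalEquality using (_≡_)
open import Relation.Binary.Construct.Closure.ReflexiveTransitive using (Star)
import Data.Vec.Relation.Binary.Pointwise.Inductive as VecPW
import Data.List.Relation.Binary.Pointwise as ListPW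
import Data.Maybe.Relation.Binary.Pointwise as MaybePW

-- Programs, following the grammar
--   P ::= Load i; P | A      A ::= App(i,j,k); A | C      C ::= Call i | ε

data CProg : Set where
  call : ℕ → CProg
  ε    : CProg

data AProg : Set where
  app  : ℕ → ℕ → ℕ → AProg → AProg
  cend : CProg → AProg

data Prog : Set where
  load : ℕ → Prog → Prog
  aend : AProg → Prog

-- Validity  I ⊨^r P.  A subset I of ℕ is represented by its
-- characteristic function ℕ → Bool; i ∈ I is  T (I i).

_∪｛_｝ : (ℕ → Bool) → ℕ → (ℕ → Bool)
(I ∪｛ k ｝) x = (x ≡ᵇ k) ∨ I x

data _⊨C[_]_ (I : ℕ → Bool) (r : ℕ) : CProg → Set where
  ⊨ε    : I ⊨C[ r ] ε
  ⊨call : ∀ {i} → T (I i) → I ⊨C[ r ] call i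

data _⊨A[_]_ : (ℕ → Bool) → ℕ → AProg → Set where
  ⊨app< : ∀ {I r i j k A} → T (I i) → T (I j) → k < r →
          (I ∪｛ k ｝) ⊨A[ r ] A → I ⊨A[ r ] app i j k A
  ⊨app≥ : ∀ {I r i j k A} → T (I i) → T (I j) → k ≥ r →
          I ⊨A[ r ] A → I ⊨A[ r ] app i j k A
  ⊨cend : ∀ {I r C} → I ⊨C[ r ] C → I ⊨A[ r ] cend C

data _⊨P[_]_ : (ℕ → Bool) → ℕ → Prog → Set where
  ⊨load< : ∀ {I r i P} → i < r → (I ∪｛ i ｝) ⊨P[ r ] P → I ⊨P[ r ] load i P
  ⊨load≥ : ∀ {I r i P} → i ≥ r → I ⊨P[ r ] P → I ⊨P[ r ] load i P
  ⊨aend  : ∀ {I r A} → I ⊨A[ r ] A → I ⊨P[ r ] aend A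

-- Register access by a natural-number index.
-- get R i = R_i for i < r, and nothing (never used) for i ≥ r.
-- upd R i x = R[R_i := x]  (identity when i ≥ r).

get : ∀ {X : Set} {r} → Vec (Maybe X) r → ℕ → Maybe X
get []       _       = nothing
get (x ∷ xs) zero    = x
get (x ∷ xs) (suc i) = get xs i

upd : ∀ {X : Set} {r} → Vec X r → ℕ → X → Vec X r
upd []       _       y = []
upd (x ∷ xs) zero    y = y ∷ xs
upd (x ∷ xs) (suc i) y = x ∷ upd xs i y

-- Addressing machines over a set of addresses Addr (∅ is nothing).

module Machines (Addr : Set) where

  occupied : ∀ {r} → Vec (Maybe Addr) r → ℕ → Bool
  occupied {r} R i = (i <ᵇ r) ∧ is-just (get R i)

  record Machine : Set where
    constructor ⟨_,_,_,_⟩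
    field
      {r}   : ℕ
      regs  : Vec (Maybe Addr) r
      prog  : Prog
      valid : occupied regs ⊨P[ r ] prog
      tape  : List Addr
  open Machine public

  _++ₘ_ : Machine → List Addr → Machine
  ⟨ R , P , v , T ⟩ ++ₘ T' = ⟨ R , P , v , T ++ T' ⟩

module Dynamics (Addr : Set) (bij : Machines.Machine Addr ↔ Addr) where
  open Machines Addr public

  # : Machine → Addr
  # = Inverse.to bij

  #⁻¹ : Addr → Machine
  #⁻¹ = Inverse.from bij

  _·_ : Addr → Addr → Addr
  a · b = # (#⁻¹ a ++ₘ (b ∷ []))

  data _→h_ : Machine → Machine → Set where
    h-load : ∀ {r} {R : Vec (Maybe Addr) r} {i P v a T v'} →
             ⟨ R , load i P , v , a ∷ T ⟩ →h ⟨ upd R i (just a) , P , v' , T ⟩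
    h-app  : ∀ {r} {R : Vec (Maybe Addr) r} {i j k A v T} {a b} {v'} →
             get R i ≡ just a → get R j ≡ just b →
             ⟨ R , aend (app i j k A) , v , T ⟩ →h
             ⟨ upd R k (just (a · b)) , aend A , v' , T ⟩
    h-call : ∀ {r} {R : Vec (Maybe Addr) r} {i v T a} →
             get R i ≡ just a →
             ⟨ R , aend (cend (call i)) , v , T ⟩ →h (#⁻¹ a ++ₘ T)

  _↠h_ : Machine → Machine → Set
  _↠h_ = Star _→h_

  mutual
    data _≡𝔸_ : Machine → Machine → Set where
      ≡𝔸-gen   : ∀ {M Z N} → M ↠h Z → Z =𝔸 N → M ≡𝔸 N
      ≡𝔸-refl  : ∀ {M} → M ≡𝔸 M
      ≡𝔸-sym   : ∀ {M N} → M ≡𝔸 N → N ≡𝔸 M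
      ≡𝔸-trans : ∀ {M N O} → M ≡𝔸 N → N ≡𝔸 O → M ≡𝔸 O

    data _=𝔸_ (M N : Machine) : Set where
      =𝔸-intro :
        VecPW.Pointwise (MaybePW.Pointwise (λ a b → #⁻¹ a ≡𝔸 #⁻¹ b))
          (regs M) (regs N) →
        prog M ≡ prog N →
        ListPW.Pointwise (λ a b → #⁻¹ a ≡𝔸 #⁻¹ b) (tape M) (tape N) →
        M =𝔸 N

  data _→c_ : Machine → Machine → Set where
    c-head : ∀ {M N} → M →h N → M →c N
    c-reg  : ∀ {r} {R : Vec (Maybe Addr) r} {P v T} {i a M'} {v'} →
             i < r → get R i ≡ just a → #⁻¹ a →c M' →
             ⟨ R , P , v , T ⟩ →c ⟨ upd R i (just (# M')) , P , v' , T ⟩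
    c-tape : ∀ {r} {R : Vec (Maybe Addr) r} {P v} {T₁ T₂ : List Addr} {a M'} →
             #⁻¹ a →c M' →
             ⟨ R , P , v , T₁ ++ a ∷ T₂ ⟩ →c ⟨ R , P , v , T₁ ++ # M' ∷ T₂ ⟩

  _↠c_ : Machine → Machine → Set
  _↠c_ = Star _→c_

{-# OPTIONS --safe #-}
module Submission where

open import Defs
open import Data.Nat using (ℕ; zero; suc)
open import Data.Product using (_×_; _,_)
open import Data.Maybe using (Maybe; just)
open import Data.Vec using (Vec; _∷_)
open import Data.List using (_∷_)
open import Function.Bundles using (_↔_; _↣_; Inverse)
open import Level using (0ℓ)
open import Relation.Binary.Core using (Rel)
open import Relation.Binary.Definitions using (Reflexive)
open import Relation.Binary.PropositionalEquality using (_≡_; refl; subst; sym)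
open import Relation.Binary.Construct.Closure.ReflexiveTransitive using (ε; _◅_; fold)
import Data.Vec.Relation.Binary.Pointwise.Inductive as VecPW
import Data.List.Relation.Binary.Pointwise as ListPW
import Data.Maybe.Relation.Binary.Pointwise as MaybePW

-- A head step is a generator of ≡𝔸 (with N =𝔸 N).  A step inside a register
-- or a tape cell leaves M =𝔸 N componentwise: the rewritten cell a and its
-- replacement # M' satisfy #⁻¹ a ≡𝔸 M' by induction on the →c derivation,
-- and #⁻¹ (# M') = M'.

Pointwise-upd : ∀ {A : Set} {ℓ} {_∼_ : Rel A ℓ} → Reflexive _∼_ →
                ∀ {r} (R : Vec (Maybe A) r) i {a b} → get R i ≡ just a → a ∼ b →
                VecPW.Pointwise (MaybePW.Pointwise _∼_) R (upd R i (just b))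
Pointwise-upd ∼-refl (_ ∷ R) zero    refl a∼b =
  MaybePW.just a∼b VecPW.∷ VecPW.refl (MaybePW.refl ∼-refl)
Pointwise-upd ∼-refl (_ ∷ R) (suc i) eq   a∼b =
  MaybePW.refl ∼-refl VecPW.∷ Pointwise-upd ∼-refl R i eq a∼b

module _ (Addr : Set) (bij : Machines.Machine Addr ↔ Addr) where
  open Dynamics Addr bij

  _≃𝔸_ : Rel Addr 0ℓ
  a ≃𝔸 b = #⁻¹ a ≡𝔸 #⁻¹ b

  ≃𝔸-refl : Reflexive _≃𝔸_
  ≃𝔸-refl = ≡𝔸-refl

  ≡𝔸⇒≃𝔸-# : ∀ {a M} → #⁻¹ a ≡𝔸 M → a ≃𝔸 # M
  ≡𝔸⇒≃𝔸-# = subst (_ ≡𝔸_) (sym (Inverse.inverseʳ bij refl))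

  regs-refl : ∀ {r} {R : Vec (Maybe Addr) r} →
              VecPW.Pointwise (MaybePW.Pointwise _≃𝔸_) R R
  regs-refl = VecPW.refl (MaybePW.refl ≃𝔸-refl)

  tape-refl : Reflexive (ListPW.Pointwise _≃𝔸_)
  tape-refl = ListPW.refl ≃𝔸-refl

  =𝔸-refl : ∀ {M} → M =𝔸 M
  =𝔸-refl = =𝔸-intro regs-refl refl tape-refl

  →c⇒≡𝔸 : ∀ {M N} → M →c N → M ≡𝔸 N
  →c⇒≡𝔸 (c-head h) = ≡𝔸-gen (h ◅ ε) =𝔸-refl
  →c⇒≡𝔸 (c-reg {R = R} {i = i} _ Rᵢ≡a a→M') =
    ≡𝔸-gen ε (=𝔸-intro (Pointwise-upd ≃𝔸-refl R i Rᵢ≡a (≡𝔸⇒≃𝔸-# (→c⇒≡𝔸 a→M')))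
                       refl tape-refl)
  →c⇒≡𝔸 (c-tape {T₁ = T₁} a→M') =
    ≡𝔸-gen ε (=𝔸-intro regs-refl refl
                       (ListPW.++⁺ˡ ≃𝔸-refl T₁ (≡𝔸⇒≃𝔸-# (→c⇒≡𝔸 a→M') ListPW.∷ tape-refl)))

  ↠c⇒≡𝔸 : ∀ {M N} → M ↠c N → M ≡𝔸 N
  ↠c⇒≡𝔸 = fold _≡𝔸_ (λ s → ≡𝔸-trans (→c⇒≡𝔸 s)) ≡𝔸-refl

lemma3p10 : (Addr : Set) → (countable : Addr ↣ ℕ) →
    (bij : Machines.Machine Addr ↔ Addr) →
    (M N : Machines.Machine Addr) →
    (Dynamics._→c_ Addr bij M N → Dynamics._≡𝔸_ Addr bij M N) ×
    (Dynamics._↠c_ Addr bij M N → Dynamics._≡𝔸_ Addr bij M N)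
lemma3p10 Addr _ bij M N = →c⇒≡𝔸 Addr bij , ↠c⇒≡𝔸 Addr bij
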